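{- If a position $G$ satisfies $G = \overline{G}$, then $G + G \in \mathcal{P}$.
   Context: Positions are defined recursively: $*L$ and $*R$ are terminal positions; if $G_1,\dots,G_n$ ($n\ge 1$) are positions, then $\{G_1,\dots,G_n\}$ is a position with options $G_1,\dots,G_n$; $=$ denotes isomorphism of positions (same game tree up to reordering options, with matching terminal labels). All positions have finite game trees. Play: Left and Right move alternately, each choosing any option of the current position; when a terminal position is reached, Left wins if it is $*L$ and Right wins if it is $*R$. Disjunctive sum: $*L + *L = *R + *R = *L$, $*L + *R = *R + *L = *R$; if at least one of $G,H$ is non-terminal, $G+H$ has options all $G'+H$ ($G'$ an option of $G$) and all $G+H'$ ($H'$ an option of $H$). Outcome class $\mathcal{P}$: the player who moves second has a winning strategy. The conjugate is defined recursively by $\overline{*L} = *R$, $\overline{*R} = *L$, and $\overline{\{G_1,\dots,G_n\}} = \{\overline{G_1},\dots,\overline{G_n}\}$. -}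

module Defs where

open import Data.Nat using (ℕ; suc; _+_)
open import Data.Fin using (Fin; splitAt)
open import Data.Sum using (_⊎_; inj₁; inj₂; [_,_])
open import Data.Product using (Σ; _×_)
open import Data.Unit using (⊤)
open import Data.Empty using (⊥)
open import Function.Bundles using (_↔_; Inverse)

-- Positions: terminal *L, *R, or a node with n ≥ 1 options,
-- given as a function from Fin (suc k) (so there are suc k ≥ 1 options).
data Pos : Set where
  *L   : Pos
  *R   : Pos
  node : (k : ℕ) → (Fin (suc k) → Pos) → Pos

_≅_ : Pos → Pos → Set
*L ≅ *L = ⊤
*L ≅ *R = ⊥
*L ≅ node _ _ = ⊥
*R ≅ *L = ⊥
*R ≅ *R = ⊤
*R ≅ node _ _ = ⊥
node _ _ ≅ *L = ⊥
node _ _ ≅ *R = ⊥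
node k f ≅ node m g =
  Σ (Fin (suc k) ↔ Fin (suc m)) λ π → (i : Fin (suc k)) → f i ≅ g (Inverse.to π i)

_⊕_ : Pos → Pos → Pos
*L ⊕ *L = *L
*L ⊕ *R = *R
*R ⊕ *L = *R
*R ⊕ *R = *L
*L ⊕ node m g = node m (λ j → *L ⊕ g j)
*R ⊕ node m g = node m (λ j → *R ⊕ g j)
node k f ⊕ *L = node k (λ i → f i ⊕ *L)
node k f ⊕ *R = node k (λ i → f i ⊕ *R)
node k f ⊕ node m g =
  node (k + suc m) (λ x → [ (λ i → f i ⊕ node m g) , (λ j → node k f ⊕ g j) ] (splitAt (suc k) x))

conj : Pos → Pos
conj *L = *R
conj *R = *L
conj (node k f) = node k (λ i → conj (f i))

LeftWins-LeftToMove  : Pos → Set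
LeftWins-RightToMove : Pos → Set
LeftWins-LeftToMove *L = ⊤
LeftWins-LeftToMove *R = ⊥
LeftWins-LeftToMove (node k f) = Σ (Fin (suc k)) λ i → LeftWins-RightToMove (f i)
LeftWins-RightToMove *L = ⊤
LeftWins-RightToMove *R = ⊥
LeftWins-RightToMove (node k f) = (i : Fin (suc k)) → LeftWins-LeftToMove (f i)

RightWins-LeftToMove  : Pos → Set
RightWins-RightToMove : Pos → Set
RightWins-LeftToMove *L = ⊥
RightWins-LeftToMove *R = ⊤
RightWins-LeftToMove (node k f) = (i : Fin (suc k)) → RightWins-RightToMove (f i)
RightWins-RightToMove *L = ⊥
RightWins-RightToMove *R = ⊤
RightWins-RightToMove (node k f) = Σ (Fin (suc k)) λ i → RightWins-LeftToMove (f i)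

-- Outcome class P: the second player has a winning strategy
-- (Right wins when Left starts, and Left wins when Right starts).
InP : Pos → Set
InP G = RightWins-LeftToMove G × LeftWins-RightToMove G

-- Left, moving second in A + B with A ≅ B, answers every move by the copy
-- of it in the other summand, and Right, moving first in A + B with
-- A ≅ conj B, does the same with the conjugate move.  Either way the
-- components stay isomorphic (resp. conjugate), so play ends in X + X = *L
-- (resp. X + conj X = *R).  For G ≅ conj G both strategies apply to G + G.
module Submission where

open import Defs
open import Data.Nat using (suc)
open import Data.Fin using (Fin; splitAt; _↑ʳ_; _↑ˡ_)
open import Data.Fin.Properties using (splitAt-↑ʳ; splitAt-↑ˡ)
open import Data.Sum using (inj₁; inj₂; [_,_])
open import Data.Product using (Σ; _,_)
open import Data.Unit using (tt)
open import Data.Empty using (⊥)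
open import Function.Bundles using (_↔_; Inverse)
open import Function.Construct.Identity using (↔-id)
open import Relation.Binary.PropositionalEquality using (_≡_; refl; cong; subst)

open Inverse using (to; from)

≅-refl : (A : Pos) → A ≅ A
≅-refl *L = tt
≅-refl *R = tt
≅-refl (node k f) = ↔-id _ , λ i → ≅-refl (f i)

matched-from : ∀ {a b ℓ} (R : Pos → Pos → Set ℓ) {f : Fin a → Pos} {g : Fin b → Pos}
               (π : Fin a ↔ Fin b) → (∀ i → R (f i) (g (to π i))) →
               ∀ j → R (f (from π j)) (g j)
matched-from R {f} {g} π p j =
  subst (λ z → R (f (from π j)) (g z)) (Inverse.strictlyInverseˡ π j) (p (from π j))

IsOption : Pos → Pos → Set
IsOption H′ *L = ⊥
IsOption H′ *R = ⊥
IsOption H′ (node k f) = Σ (Fin (suc k)) λ i → f i ≡ H′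

⊕-optionˡ : ∀ {A A′} B → IsOption A′ A → IsOption (A′ ⊕ B) (A ⊕ B)
⊕-optionˡ {node k f} *L (i , refl) = i , refl
⊕-optionˡ {node k f} *R (i , refl) = i , refl
⊕-optionˡ {node k f} (node m g) (i , refl) =
  i ↑ˡ suc m , cong [ (λ i → f i ⊕ node m g) , (λ j → node k f ⊕ g j) ] (splitAt-↑ˡ (suc k) i (suc m))

⊕-optionʳ : ∀ A {B B′} → IsOption B′ B → IsOption (A ⊕ B′) (A ⊕ B)
⊕-optionʳ *L {node m g} (j , refl) = j , refl
⊕-optionʳ *R {node m g} (j , refl) = j , refl
⊕-optionʳ (node k f) {node m g} (j , refl) =
  suc k ↑ʳ j , cong [ (λ i → f i ⊕ node m g) , (λ j → node k f ⊕ g j) ] (splitAt-↑ʳ (suc k) (suc m) j)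

leftWins-byMove : ∀ {H H′} → IsOption H′ H → LeftWins-RightToMove H′ → LeftWins-LeftToMove H
leftWins-byMove {node k f} (i , refl) w = i , w

rightWins-byMove : ∀ {H H′} → IsOption H′ H → RightWins-LeftToMove H′ → RightWins-RightToMove H
rightWins-byMove {node k f} (i , refl) w = i , w

copy-strategy : (A B : Pos) → A ≅ B → LeftWins-RightToMove (A ⊕ B)
copy-strategy *L *L _ = tt
copy-strategy *R *R _ = tt
copy-strategy (node k f) (node m g) (π , p) x with splitAt (suc k) x
... | inj₁ i = leftWins-byMove (⊕-optionʳ (f i) (to π i , refl))
                 (copy-strategy (f i) (g (to π i)) (p i))
... | inj₂ j = leftWins-byMove (⊕-optionˡ (g j) (from π j , refl))
                 (copy-strategy (f (from π j)) (g j) (matched-from _≅_ π p j))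

mirror-strategy : (A B : Pos) → A ≅ conj B → RightWins-LeftToMove (A ⊕ B)
mirror-strategy *L *R _ = tt
mirror-strategy *R *L _ = tt
mirror-strategy (node k f) (node m g) (π , p) x with splitAt (suc k) x
... | inj₁ i = rightWins-byMove (⊕-optionʳ (f i) (to π i , refl))
                 (mirror-strategy (f i) (g (to π i)) (p i))
... | inj₂ j = rightWins-byMove (⊕-optionˡ (g j) (from π j , refl))
                 (mirror-strategy (f (from π j)) (g j)
                   (matched-from (λ X Y → X ≅ conj Y) π p j))

proposition2p15 : (G : Pos) → G ≅ conj G → InP (G ⊕ G)
proposition2p15 G G≅conjG = mirror-strategy G G G≅conjG , copy-strategy G G (≅-refl G)
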